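{- Let $L=(V,E)$ be a connected simple graph on $\bar{n}=|V|$ vertices and $k\in\{1,\dots,\bar{n}-1\}$. The graph $L$ is bipartite if and only if $\mathfrak{L}_k$ is bipartite.
   Context: For a finite simple graph $L=(V,E)$ and $k\in\{1,\dots,|V|-1\}$, the $k$-particle graph $\mathfrak{L}_k=(\mathfrak{V}_k,\mathfrak{E}_k)$ has vertex set $\mathfrak{V}_k$ consisting of all subsets of $V$ of size $k$, and $\langle\mathfrak{v},\mathfrak{w}\rangle\in\mathfrak{E}_k$ if and only if $\mathfrak{v}\triangle\mathfrak{w}=\{v,w\}$ with $\langle v,w\rangle\in E$. -}

module Defs where

open import Data.Nat using (ℕ; suc; _≤_; _<_)
open import Data.Bool using (Bool; true; false; _xor_)
open import Data.Fin using (Fin)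
open import Data.Fin.Subset using (Subset; ⁅_⁆; _∪_; ∣_∣)
open import Data.Vec using (zipWith)
open import Data.Product using (Σ; ∃; ∃-syntax; _×_; _,_)
open import Relation.Binary.PropositionalEquality using (_≡_; _≢_)

record SimpleGraph (n : ℕ) : Set where
  field
    adj     : Fin n → Fin n → Bool
    sym     : ∀ v w → adj v w ≡ adj w v
    irrefl  : ∀ v → adj v v ≡ false

open SimpleGraph public

data Walk {X : Set} (E : X → X → Set) : X → X → Set where
  [] : ∀ {x} → Walk E x x
  _∷_ : ∀ {x y z} → E x y → Walk E y z → Walk E x z

Connected : {X : Set} → (X → X → Set) → Set
Connected {X} E = ∀ (x y : X) → Walk E x y

Bipartite : {X : Set} → (X → X → Set) → Set
Bipartite {X} E = Σ (X → Bool) λ c → ∀ x y → E x y → c x ≢ c y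

Edge : ∀ {n} → SimpleGraph n → Fin n → Fin n → Set
Edge L v w = adj L v w ≡ true

_△_ : ∀ {n} → Subset n → Subset n → Subset n
p △ q = zipWith _xor_ p q

-- vertices of the k-particle graph: k-element subsets of V
ParticleVertex : ℕ → ℕ → Set
ParticleVertex n k = Σ (Subset n) λ s → ∣ s ∣ ≡ k

ParticleEdge : ∀ {n} → SimpleGraph n → (k : ℕ) → ParticleVertex n k → ParticleVertex n k → Set
ParticleEdge {n} L k (s , _) (t , _) =
  ∃[ v ] ∃[ w ] (Edge L v w × (s △ t ≡ ⁅ v ⁆ ∪ ⁅ w ⁆))

{-# OPTIONS --safe #-}
-- Forward: colour a k-set by the parity of its members' colours; an edge of 𝔏_k moves
-- one particle along an edge of L, which flips that parity.
-- Backward: a connected graph is bipartite once all its closed walks are even.  If c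
-- properly colours 𝔏_k, exchanging the memberships of v and w in a k-set x changes c x
-- exactly when x separates v and w and the given walk from v to w has odd length: by
-- induction on the walk v → a ⇝ w, since exchanging v and w is exchanging a and w
-- conjugated by exchanging v and a.  For a closed walk w → a ⇝ w and a k-set separating
-- a and w (one exists as 1 ≤ k < n), comparing this with the edge a–w shows that a ⇝ w
-- is odd.
module Submission where

open import Defs hiding (sym)
open import Data.Bool using (Bool; true; false; not; _∧_; _∨_; _xor_)
open import Data.Bool.Properties
  using ( xor-same; xor-comm; xor-identityʳ; xor-inverseˡ; xor-inverseʳ; not-distribˡ-xor
        ; not-injective; ¬-not; not-¬; ∧-identityʳ; xor-∧-commutativeRing )
  renaming (_≟_ to _≟ᵇ_)
open import Data.Empty using (⊥-elim)
open import Data.Fin using (Fin; zero; suc; _≟_; fromℕ<)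
open import Data.Fin.Subset using (Subset; ⊥; ⁅_⁆; _∪_; ∣_∣)
open import Data.Fin.Subset.Properties using (∣⊥∣≡0; ∪-identityˡ; ∪-identityʳ; x∈⁅x⁆; x≢y⇒x∉⁅y⁆)
open import Data.Maybe using (just; nothing)
open import Data.Nat using (ℕ; zero; suc; _≤_; _<_; z≤n; s≤s)
open import Data.Nat.Properties using (≡-irrelevant; suc-injective; <⇒≤)
open import Data.Product using (∃; _,_; proj₁; proj₂)
open import Data.Product.Properties using (Σ-≡,≡→≡)
open import Data.Vec using ([]; _∷_; lookup; _[_]≔_)
open import Data.Vec.Properties using (lookup∘update; lookup∘update′; lookup-zipWith; []=⇒lookup; lookup⇒[]=)
open import Data.Vec.Relation.Binary.Pointwise.Extensional using (ext; Pointwise-≡⇒≡)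
open import Function using (_∘_)
open import Function.Bundles using (_⇔_; mk⇔)
open import Relation.Binary.PropositionalEquality
  using (_≡_; _≢_; refl; sym; trans; cong; cong₂; ≢-sym; module ≡-Reasoning)
open import Relation.Nullary using (yes; no; contradiction)
open import Tactic.RingSolver using (solve-∀)
open import Tactic.RingSolver.Core.AlmostCommutativeRing using (AlmostCommutativeRing; fromCommutativeRing)

open ≡-Reasoning

private
  variable
    n k : ℕ
    X : Set
    E : X → X → Set
    x y z : X
    u v w a : Fin n

Bool-ring : AlmostCommutativeRing _ _
Bool-ring = fromCommutativeRing xor-∧-commutativeRing λ { false → just refl ; true → nothing }

xor-∧-distrib-interchange : ∀ p q r s t → ((p xor q) ∧ r) xor (s xor t) ≡ ((p ∧ r) xor s) xor ((q ∧ r) xor t)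
xor-∧-distrib-interchange = solve-∀ Bool-ring

xor-telescope : ∀ c p q r o → ((c xor (p xor q)) xor ((p xor r) ∧ o)) xor (q xor r) ≡ c xor ((p xor r) ∧ (true xor o))
xor-telescope = solve-∀ Bool-ring

xor-≢ : ∀ {p q} → p ≢ q → p xor q ≡ true
xor-≢ {p} p≢q = trans (cong (p xor_) (¬-not (≢-sym p≢q))) (xor-inverseʳ p)

xor≡false⇒≡ : ∀ p q → p xor q ≡ false → p ≡ q
xor≡false⇒≡ false false _ = refl
xor≡false⇒≡ true  true  _ = refl

xor-cancelˡ : ∀ p {q r} → p xor q ≡ p xor r → q ≡ r
xor-cancelˡ false eq = eq
xor-cancelˡ true  eq = not-injective eq

length : Walk E x y → ℕ
length []      = 0
length (_ ∷ p) = suc (length p)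

_++_ : Walk E x y → Walk E y z → Walk E x z
[]      ++ q = q
(e ∷ p) ++ q = e ∷ (p ++ q)

odd : ℕ → Bool
odd zero    = false
odd (suc m) = not (odd m)

odd-length-++ : (p : Walk E x y) (q : Walk E y z) →
                odd (length (p ++ q)) ≡ odd (length p) xor odd (length q)
odd-length-++ []      q = refl
odd-length-++ (e ∷ p) q = trans (cong not (odd-length-++ p q)) (not-distribˡ-xor (odd (length p)) (odd (length q)))

-- Adjacent vertices x, y of equal colour would give the odd closed walk root ⇝ x → y ⇝ root.
closedWalksEven⇒bipartite : {X : Set} {E : X → X → Set} → Connected E → X →
                            (∀ {x} (p : Walk E x x) → odd (length p) ≡ false) → Bipartite E
closedWalksEven⇒bipartite {X = X} {E = E} conn r even = colour , proper
  where
  colour : X → Bool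
  colour x = odd (length (conn r x))

  return-parity : ∀ x → odd (length (conn x r)) ≡ colour x
  return-parity x = sym (xor≡false⇒≡ _ _
    (trans (sym (odd-length-++ (conn r x) (conn x r))) (even (conn r x ++ conn x r))))

  proper : ∀ x y → E x y → colour x ≢ colour y
  proper x y e same = contradiction odd-cycle λ ()
    where
    odd-cycle : true ≡ false
    odd-cycle = begin
      true                                       ≡⟨ xor-inverseʳ (colour x) ⟨
      colour x xor not (colour x)                ≡⟨ cong (λ b → colour x xor not b)
                                                         (trans same (sym (return-parity y))) ⟩
      colour x xor not (odd (length (conn y r))) ≡⟨ odd-length-++ (conn r x) (e ∷ conn y r) ⟨
      odd (length (conn r x ++ (e ∷ conn y r)))  ≡⟨ even (conn r x ++ (e ∷ conn y r)) ⟩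
      false                                      ∎

edge-sym : (L : SimpleGraph n) → Edge L v w → Edge L w v
edge-sym {v = v} {w} L e = trans (SimpleGraph.sym L w v) e

edge⇒≢ : (L : SimpleGraph n) → Edge L v w → v ≢ w
edge⇒≢ {v = v} L e refl = contradiction (trans (sym e) (irrefl L v)) λ ()

lookup-⁅⁆-self : ∀ (v : Fin n) → lookup ⁅ v ⁆ v ≡ true
lookup-⁅⁆-self v = []=⇒lookup (x∈⁅x⁆ v)

lookup-⁅⁆-other : u ≢ v → lookup ⁅ v ⁆ u ≡ false
lookup-⁅⁆-other u≢v = ¬-not (x≢y⇒x∉⁅y⁆ u≢v ∘ lookup⇒[]= _ _)

swap : Fin n → Fin n → Subset n → Subset n
swap v w s = (s [ v ]≔ lookup s w) [ w ]≔ lookup s v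

lookup∘swapˡ : ∀ v w (s : Subset n) → lookup (swap v w s) v ≡ lookup s w
lookup∘swapˡ v w s with v ≟ w
... | yes refl = lookup∘update v (s [ v ]≔ lookup s v) (lookup s v)
... | no v≢w   =
  trans (lookup∘update′ v≢w (s [ v ]≔ lookup s w) (lookup s v)) (lookup∘update v s (lookup s w))

lookup∘swapʳ : ∀ v w (s : Subset n) → lookup (swap v w s) w ≡ lookup s v
lookup∘swapʳ v w s = lookup∘update w (s [ v ]≔ lookup s w) (lookup s v)

lookup∘swap′ : u ≢ v → u ≢ w → ∀ (s : Subset n) → lookup (swap v w s) u ≡ lookup s u
lookup∘swap′ {v = v} {w} u≢v u≢w s =
  trans (lookup∘update′ u≢w (s [ v ]≔ lookup s w) (lookup s v)) (lookup∘update′ u≢v s (lookup s w))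

swap-id : ∀ (s : Subset n) → lookup s v ≡ lookup s w → swap v w s ≡ s
swap-id {v = v} {w} s sv≡sw = Pointwise-≡⇒≡ (ext pointwise)
  where
  pointwise : ∀ u → lookup (swap v w s) u ≡ lookup s u
  pointwise u with u ≟ v | u ≟ w
  ... | yes refl | _        = trans (lookup∘swapˡ v w s) (sym sv≡sw)
  ... | no _     | yes refl = trans (lookup∘swapʳ v w s) sv≡sw
  ... | no u≢v   | no u≢w   = lookup∘swap′ u≢v u≢w s

swap-conjugate : v ≢ a → a ≢ w → v ≢ w → ∀ (s : Subset n) →
                 swap v a (swap a w (swap v a s)) ≡ swap v w s
swap-conjugate {v = v} {a} {w} v≢a a≢w v≢w s = Pointwise-≡⇒≡ (ext pointwise)
  where
  s₁ = swap v a s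
  s₂ = swap a w s₁
  pointwise : ∀ u → lookup (swap v a s₂) u ≡ lookup (swap v w s) u
  pointwise u with u ≟ v | u ≟ a | u ≟ w
  ... | yes refl | _ | _ =
    trans (lookup∘swapˡ v a s₂) (trans (lookup∘swapˡ a w s₁)
      (trans (lookup∘swap′ (≢-sym v≢w) (≢-sym a≢w) s) (sym (lookup∘swapˡ v w s))))
  ... | no _ | yes refl | _ =
    trans (lookup∘swapʳ v a s₂) (trans (lookup∘swap′ v≢a v≢w s₁)
      (trans (lookup∘swapˡ v a s) (sym (lookup∘swap′ (≢-sym v≢a) a≢w s))))
  ... | no u≢v | no u≢a | yes refl =
    trans (lookup∘swap′ u≢v u≢a s₂) (trans (lookup∘swapʳ a w s₁)
      (trans (lookup∘swapʳ v a s) (sym (lookup∘swapʳ v w s))))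
  ... | no u≢v | no u≢a | no u≢w =
    trans (lookup∘swap′ u≢v u≢a s₂) (trans (lookup∘swap′ u≢a u≢w s₁)
      (trans (lookup∘swap′ u≢v u≢a s) (sym (lookup∘swap′ u≢v u≢w s))))

∣update-true∣ : ∀ (s : Subset n) i → lookup s i ≡ false → ∣ s [ i ]≔ true ∣ ≡ suc ∣ s ∣
∣update-true∣ (false ∷ s) zero    _  = refl
∣update-true∣ (true  ∷ s) (suc i) si = cong suc (∣update-true∣ s i si)
∣update-true∣ (false ∷ s) (suc i) si = ∣update-true∣ s i si

∣update-false∣ : ∀ (s : Subset n) i → lookup s i ≡ true → suc ∣ s [ i ]≔ false ∣ ≡ ∣ s ∣
∣update-false∣ (true  ∷ s) zero    _  = refl
∣update-false∣ (true  ∷ s) (suc i) si = cong suc (∣update-false∣ s i si)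
∣update-false∣ (false ∷ s) (suc i) si = ∣update-false∣ s i si

∣swap∣ : ∀ v w (s : Subset n) → ∣ swap v w s ∣ ≡ ∣ s ∣
∣swap∣ v w s = by-memberships (lookup s v) (lookup s w) refl refl
  where
  by-memberships : ∀ b b′ → lookup s v ≡ b → lookup s w ≡ b′ → ∣ swap v w s ∣ ≡ ∣ s ∣
  by-memberships true  true  sv sw = cong ∣_∣ (swap-id s (trans sv (sym sw)))
  by-memberships false false sv sw = cong ∣_∣ (swap-id s (trans sv (sym sw)))
  by-memberships true  false sv sw = begin
    ∣ (s [ v ]≔ lookup s w) [ w ]≔ lookup s v ∣ ≡⟨ cong₂ (λ b b′ → ∣ (s [ v ]≔ b) [ w ]≔ b′ ∣) sw sv ⟩
    ∣ (s [ v ]≔ false) [ w ]≔ true ∣           ≡⟨ ∣update-true∣ (s [ v ]≔ false) w (trans (lookup∘update′ w≢v s false) sw) ⟩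
    suc ∣ s [ v ]≔ false ∣                     ≡⟨ ∣update-false∣ s v sv ⟩
    ∣ s ∣                                      ∎
    where
    w≢v : w ≢ v
    w≢v refl = contradiction (trans (sym sv) sw) λ ()
  by-memberships false true  sv sw = suc-injective (begin
    suc ∣ (s [ v ]≔ lookup s w) [ w ]≔ lookup s v ∣ ≡⟨ cong₂ (λ b b′ → suc ∣ (s [ v ]≔ b) [ w ]≔ b′ ∣) sw sv ⟩
    suc ∣ (s [ v ]≔ true) [ w ]≔ false ∣           ≡⟨ ∣update-false∣ (s [ v ]≔ true) w (trans (lookup∘update′ w≢v s true) sw) ⟩
    ∣ s [ v ]≔ true ∣                              ≡⟨ ∣update-true∣ s v sv ⟩
    suc ∣ s ∣                                      ∎)
    where
    w≢v : w ≢ v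
    w≢v refl = contradiction (trans (sym sw) sv) λ ()

swap-△ : ∀ (s : Subset n) → lookup s v ≢ lookup s w → s △ swap v w s ≡ ⁅ v ⁆ ∪ ⁅ w ⁆
swap-△ {v = v} {w} s sv≢sw = Pointwise-≡⇒≡ (ext pointwise)
  where
  pointwise : ∀ u → lookup (s △ swap v w s) u ≡ lookup (⁅ v ⁆ ∪ ⁅ w ⁆) u
  pointwise u rewrite lookup-zipWith _xor_ u s (swap v w s) | lookup-zipWith _∨_ u ⁅ v ⁆ ⁅ w ⁆
    with u ≟ v | u ≟ w
  ... | yes refl | _ rewrite lookup∘swapˡ v w s | lookup-⁅⁆-self v = xor-≢ sv≢sw
  ... | no u≢v | yes refl rewrite lookup∘swapʳ v w s | lookup-⁅⁆-other u≢v | lookup-⁅⁆-self w =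
    xor-≢ (≢-sym sv≢sw)
  ... | no u≢v | no u≢w rewrite lookup∘swap′ u≢v u≢w s | lookup-⁅⁆-other u≢v | lookup-⁅⁆-other u≢w =
    xor-same (lookup s u)

separates : Subset n → Fin n → Fin n → Bool
separates s v w = lookup s v xor lookup s w

swap-separates : ∀ (s : Subset n) → lookup s u ≡ not (lookup s w) → v ≢ w → separates (swap v u s) v w ≡ true
swap-separates {u = u} {w} {v} s su v≢w = begin
  lookup (swap v u s) v xor lookup (swap v u s) w ≡⟨ cong₂ _xor_ (trans (lookup∘swapˡ v u s) su)
                                                                   (lookup∘swap′ (≢-sym v≢w) w≢u s) ⟩
  not (lookup s w) xor lookup s w                 ≡⟨ xor-inverseˡ (lookup s w) ⟩
  true                                            ∎
  where
  w≢u : w ≢ u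
  w≢u refl = not-¬ refl su

particle-≡ : {x y : ParticleVertex n k} → proj₁ x ≡ proj₁ y → x ≡ y
particle-≡ eq = Σ-≡,≡→≡ (eq , ≡-irrelevant _ _)

swapᵖ : Fin n → Fin n → ParticleVertex n k → ParticleVertex n k
swapᵖ v w x = swap v w (proj₁ x) , trans (∣swap∣ v w (proj₁ x)) (proj₂ x)

initialSegment : k ≤ n → Subset n
initialSegment z≤n       = ⊥
initialSegment (s≤s k≤n) = true ∷ initialSegment k≤n

∣initialSegment∣ : (k≤n : k ≤ n) → ∣ initialSegment k≤n ∣ ≡ k
∣initialSegment∣ {n = n} z≤n = ∣⊥∣≡0 n
∣initialSegment∣ (s≤s k≤n)   = cong suc (∣initialSegment∣ k≤n)

initialSegment-member : 1 ≤ k → (k≤n : k ≤ n) → ∃ λ i → lookup (initialSegment k≤n) i ≡ true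
initialSegment-member (s≤s _) (s≤s _) = zero , refl

initialSegment-nonmember : (k≤n : k ≤ n) → k < n → ∃ λ i → lookup (initialSegment k≤n) i ≡ false
initialSegment-nonmember z≤n       (s≤s _)   = zero , refl
initialSegment-nonmember (s≤s k≤n) (s≤s k<n) =
  let i , eq = initialSegment-nonmember k≤n k<n in suc i , eq

separating : 1 ≤ k → k < n → v ≢ w → ∃ λ (x : ParticleVertex n k) → separates (proj₁ x) v w ≡ true
separating {v = v} {w} 1≤k k<n v≢w =
  let u , su = occurs (not (lookup s w)) in swapᵖ v u (s , ∣initialSegment∣ k≤n) , swap-separates s su v≢w
  where
  k≤n = <⇒≤ k<n
  s = initialSegment k≤n
  occurs : ∀ b → ∃ λ u → lookup s u ≡ b
  occurs true  = initialSegment-member 1≤k k≤n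
  occurs false = initialSegment-nonmember k≤n k<n

parity : (Fin n → Bool) → Subset n → Bool
parity b []      = false
parity b (p ∷ s) = (p ∧ b zero) xor parity (b ∘ suc) s

parity-⊥ : ∀ (b : Fin n → Bool) → parity b ⊥ ≡ false
parity-⊥ {zero}  b = refl
parity-⊥ {suc n} b = parity-⊥ (b ∘ suc)

parity-⁅⁆ : ∀ (b : Fin n → Bool) v → parity b ⁅ v ⁆ ≡ b v
parity-⁅⁆ b zero    = trans (cong (b zero xor_) (parity-⊥ (b ∘ suc))) (xor-identityʳ (b zero))
parity-⁅⁆ b (suc v) = parity-⁅⁆ (b ∘ suc) v

parity-△ : ∀ (b : Fin n → Bool) s t → parity b (s △ t) ≡ parity b s xor parity b t
parity-△ b []      []      = refl
parity-△ b (p ∷ s) (q ∷ t) = trans (cong (((p xor q) ∧ b zero) xor_) (parity-△ (b ∘ suc) s t))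
                                   (xor-∧-distrib-interchange p q (b zero) _ _)

parity-⁅⁆∪⁅⁆ : ∀ (b : Fin n → Bool) → v ≢ w → parity b (⁅ v ⁆ ∪ ⁅ w ⁆) ≡ b v xor b w
parity-⁅⁆∪⁅⁆ {v = zero} {w = zero} b  v≢w = ⊥-elim (v≢w refl)
parity-⁅⁆∪⁅⁆ {v = zero} {w = suc w} b _   =
  cong (b zero xor_) (trans (cong (parity (b ∘ suc)) (∪-identityˡ ⁅ w ⁆)) (parity-⁅⁆ (b ∘ suc) w))
parity-⁅⁆∪⁅⁆ {v = suc v} {w = zero} b  _   =
  trans (cong (b zero xor_) (trans (cong (parity (b ∘ suc)) (∪-identityʳ ⁅ v ⁆)) (parity-⁅⁆ (b ∘ suc) v)))
        (xor-comm (b zero) (b (suc v)))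
parity-⁅⁆∪⁅⁆ {v = suc v} {w = suc w} b v≢w = parity-⁅⁆∪⁅⁆ (b ∘ suc) (v≢w ∘ cong suc)

bipartite⇒particleBipartite : (L : SimpleGraph n) → Bipartite (Edge L) → Bipartite (ParticleEdge L k)
bipartite⇒particleBipartite {k = k} L (b , proper) = parity b ∘ proj₁ , proper′
  where
  proper′ : ∀ x y → ParticleEdge L k x y → parity b (proj₁ x) ≢ parity b (proj₁ y)
  proper′ (s , _) (t , _) (v , w , e , s△t) same = contradiction flipped λ ()
    where
    flipped : true ≡ false
    flipped = begin
      true                      ≡⟨ xor-≢ (proper v w e) ⟨
      b v xor b w               ≡⟨ parity-⁅⁆∪⁅⁆ b (edge⇒≢ L e) ⟨
      parity b (⁅ v ⁆ ∪ ⁅ w ⁆)  ≡⟨ cong (parity b) s△t ⟨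
      parity b (s △ t)          ≡⟨ parity-△ b s t ⟩
      parity b s xor parity b t ≡⟨ cong (parity b s xor_) same ⟨
      parity b s xor parity b s ≡⟨ xor-same (parity b s) ⟩
      false                     ∎

module ProperColouring (L : SimpleGraph n) (c : ParticleVertex n k → Bool)
                       (proper : ∀ x y → ParticleEdge L k x y → c x ≢ c y) where

  colour-swapᵖ-self : ∀ x o → c (swapᵖ v v x) ≡ c x xor (separates (proj₁ x) v v ∧ o)
  colour-swapᵖ-self {v = v} x o = begin
    c (swapᵖ v v x)                       ≡⟨ cong c (particle-≡ (swap-id (proj₁ x) refl)) ⟩
    c x                                   ≡⟨ xor-identityʳ (c x) ⟨
    c x xor (false ∧ o)                   ≡⟨ cong (λ σ → c x xor (σ ∧ o)) (xor-same (lookup (proj₁ x) v)) ⟨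
    c x xor (separates (proj₁ x) v v ∧ o) ∎

  colour-swapᵖ-edge : Edge L v w → ∀ x → c (swapᵖ v w x) ≡ c x xor separates (proj₁ x) v w
  colour-swapᵖ-edge {v = v} {w} e x with lookup (proj₁ x) v ≟ᵇ lookup (proj₁ x) w
  ... | yes sv≡sw = begin
    c (swapᵖ v w x)                 ≡⟨ cong c (particle-≡ (swap-id (proj₁ x) sv≡sw)) ⟩
    c x                             ≡⟨ xor-identityʳ (c x) ⟨
    c x xor false                   ≡⟨ cong (c x xor_) (xor-same (lookup (proj₁ x) w)) ⟨
    c x xor separates (proj₁ x) w w ≡⟨ cong (λ b → c x xor (b xor lookup (proj₁ x) w)) sv≡sw ⟨
    c x xor separates (proj₁ x) v w ∎
  ... | no sv≢sw = begin
    c (swapᵖ v w x)                 ≡⟨ ¬-not (≢-sym (proper x (swapᵖ v w x) (v , w , e , swap-△ (proj₁ x) sv≢sw))) ⟩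
    not (c x)                       ≡⟨ xor-comm (c x) true ⟨
    c x xor true                    ≡⟨ cong (c x xor_) (xor-≢ sv≢sw) ⟨
    c x xor separates (proj₁ x) v w ∎

  module _ (separating : ∀ {v w} → v ≢ w → ∃ λ (x : ParticleVertex n k) → separates (proj₁ x) v w ≡ true) where

    mutual
      colour-swapᵖ-walk : (p : Walk (Edge L) v w) → ∀ x →
                          c (swapᵖ v w x) ≡ c x xor (separates (proj₁ x) v w ∧ odd (length p))
      colour-swapᵖ-walk []  x = colour-swapᵖ-self x false
      colour-swapᵖ-walk {v = v} {w} (_∷_ {y = a} e rest) x with v ≟ w | a ≟ w
      ... | yes refl | _        = colour-swapᵖ-self x _
      ... | no _     | yes refl = begin
        c (swapᵖ v w x)                           ≡⟨ colour-swapᵖ-edge e x ⟩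
        c x xor σ                                 ≡⟨ cong (c x xor_) (∧-identityʳ σ) ⟨
        c x xor (σ ∧ true)                        ≡⟨ cong (λ o → c x xor (σ ∧ not o)) (closedWalk-even rest) ⟨
        c x xor (σ ∧ not (odd (length rest)))     ∎
        where σ = separates (proj₁ x) v w
      ... | no v≢w   | no a≢w   = begin
        c (swapᵖ v w x)                                         ≡⟨ cong c (particle-≡ (swap-conjugate v≢a a≢w v≢w s)) ⟨
        c (swapᵖ v a x₂)                                        ≡⟨ colour-swapᵖ-edge e x₂ ⟩
        c x₂ xor separates s₂ v a                               ≡⟨ cong₂ _xor_ (colour-swapᵖ-walk rest x₁) separates-s₂ ⟩
        (c x₁ xor (separates s₁ a w ∧ o)) xor separates s a w   ≡⟨ cong₂ (λ d σ → (d xor (σ ∧ o)) xor separates s a w)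
                                                                         (colour-swapᵖ-edge e x) separates-s₁ ⟩
        ((c x xor separates s v a) xor (separates s v w ∧ o)) xor separates s a w
                                                                ≡⟨ xor-telescope (c x) (lookup s v) (lookup s a) (lookup s w) o ⟩
        c x xor (separates s v w ∧ not o)                       ∎
        where
        o  = odd (length rest)
        s  = proj₁ x
        x₁ = swapᵖ v a x
        s₁ = proj₁ x₁
        x₂ = swapᵖ a w x₁
        s₂ = proj₁ x₂
        v≢a : v ≢ a
        v≢a = edge⇒≢ L e
        separates-s₁ : separates s₁ a w ≡ separates s v w
        separates-s₁ = cong₂ _xor_ (lookup∘swapʳ v a s) (lookup∘swap′ (≢-sym v≢w) (≢-sym a≢w) s)
        separates-s₂ : separates s₂ v a ≡ separates s a w
        separates-s₂ = cong₂ _xor_ (trans (lookup∘swap′ v≢a v≢w s₁) (lookup∘swapˡ v a s))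
                                   (trans (lookup∘swapˡ a w s₁) (lookup∘swap′ (≢-sym v≢w) (≢-sym a≢w) s))

      closedWalk-even : (p : Walk (Edge L) w w) → odd (length p) ≡ false
      closedWalk-even []  = refl
      closedWalk-even {w = w} (_∷_ {y = a} e rest) with separating (edge⇒≢ L (edge-sym L e))
      ... | x , σ≡true = cong not (sym (xor-cancelˡ (c x) (begin
        c x xor true                                          ≡⟨ cong (c x xor_) σ≡true ⟨
        c x xor separates (proj₁ x) a w                       ≡⟨ colour-swapᵖ-edge (edge-sym L e) x ⟨
        c (swapᵖ a w x)                                       ≡⟨ colour-swapᵖ-walk rest x ⟩
        c x xor (separates (proj₁ x) a w ∧ odd (length rest)) ≡⟨ cong (λ σ → c x xor (σ ∧ odd (length rest))) σ≡true ⟩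
        c x xor odd (length rest)                             ∎)))

theorem3p2 : (n : ℕ) (L : SimpleGraph n) → Connected (Edge L) →
    (k : ℕ) → 1 ≤ k → k < n →
    Bipartite (Edge L) ⇔ Bipartite (ParticleEdge L k)
theorem3p2 n L conn k 1≤k k<n = mk⇔ (bipartite⇒particleBipartite L) λ (c , proper) →
  closedWalksEven⇒bipartite conn (fromℕ< k<n)
    (ProperColouring.closedWalk-even L c proper (separating 1≤k k<n))
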